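{- Let $H$ be a bipartite graph with ${\rm hcf}_c(H)\ne 1$ and let $k\in\mathbb{N}$. If ${\rm hcf}_c(H)=2$ and $k|H|$ is not divisible by $4$, let $G_2$ be the disjoint union of two cliques of order $k|H|/2$. Otherwise let $G_2$ be the disjoint union of two cliques of orders $\lfloor k|H|/2\rfloor+1$ and $\lceil k|H|/2\rceil-1$. Then $G_2$ does not contain a perfect $H$-packing.
   Context: ${\rm hcf}_c(H)$ denotes the highest common factor of the orders (numbers of vertices) of the connected components of $H$. A perfect $H$-packing in $G$ is a collection of vertex-disjoint copies of $H$ in $G$ covering all vertices of $G$. -}

module Defs where

open import Data.Nat using (ℕ; zero; suc; _+_; _*_; _∸_; ⌊_/2⌋; ⌈_/2⌉; _<ᵇ_; _≤_)
open import Data.Nat.GCD using (gcd)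
open import Data.Nat.Divisibility using (_∣_; _∣?_)
open import Data.Bool using (Bool; true; false; _∧_; _∨_; not; if_then_else_)
open import Data.Bool.Properties using () renaming (_≟_ to _≟ᵇ_)
open import Data.Fin using (Fin; toℕ) renaming (_≟_ to _≟ᶠ_)
open import Data.List using (List; foldr; map; length; filterᵇ)
open import Data.Bool.ListAction using (any)
open import Data.List.Base using (allFin)
open import Data.Product using (Σ; ∃; ∃-syntax; _×_; _,_)
open import Relation.Nullary using (¬_; yes; no)
open import Relation.Nullary.Decidable using (⌊_⌋)
open import Relation.Binary.PropositionalEquality using (_≡_; _≢_)

record Graph : Set where
  field
    order : ℕ
    adj   : Fin order → Fin order → Bool
    adj-sym    : ∀ u v → adj u v ≡ adj v u
    adj-irrefl : ∀ u → adj u u ≡ false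
open Graph public

∣_∣ᵥ : Graph → ℕ
∣ G ∣ᵥ = order G

Bipartite : Graph → Set
Bipartite G = Σ (Fin (order G) → Bool) λ c →
  ∀ u v → adj G u v ≡ true → c u ≢ c v

reachWithin : (G : Graph) → ℕ → Fin (order G) → Fin (order G) → Bool
reachWithin G zero    u v = ⌊ u ≟ᶠ v ⌋
reachWithin G (suc k) u v =
  reachWithin G k u v ∨ any (λ w → reachWithin G k u w ∧ adj G w v) (allFin (order G))

-- u and v lie in the same connected component (walks of length < |G| suffice).
sameComponent : (G : Graph) → Fin (order G) → Fin (order G) → Bool
sameComponent G = reachWithin G (order G)

componentOrder : (G : Graph) → Fin (order G) → ℕ
componentOrder G v = length (filterᵇ (sameComponent G v) (allFin (order G)))

-- hcf_c(G): highest common factor of the orders of the connected components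
-- (gcd over all vertices of the order of their component; repetitions are harmless).
hcfc : Graph → ℕ
hcfc G = foldr gcd 0 (map (componentOrder G) (allFin (order G)))

-- A perfect H-packing in G: copies e i (i : Fin m) of H in G (edge-preserving maps),
-- such that (i , u) ↦ e i u is a bijection onto V(G)
-- (injective: copies are vertex-disjoint and injective; surjective: they cover V(G)).
PerfectPacking : (H G : Graph) → Set
PerfectPacking H G =
  ∃[ m ] Σ (Fin m → Fin (order H) → Fin (order G)) λ e →
    (∀ i u v → adj H u v ≡ true → adj G (e i u) (e i v) ≡ true)
    × (∀ i j u v → e i u ≡ e j v → (i ≡ j × u ≡ v))
    × (∀ x → ∃[ i ] ∃[ u ] e i u ≡ x)

-- Disjoint union of two cliques of orders a and b, on vertex set Fin (a + b):
-- the first a vertices form one clique, the remaining b the other.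
twoCliques : ℕ → ℕ → Graph
twoCliques a b = record
  { order = a + b
  ; adj = λ u v → not ⌊ u ≟ᶠ v ⌋ ∧ ⌊ (toℕ u <ᵇ a) ≟ᵇ (toℕ v <ᵇ a) ⌋
  ; adj-sym = sym′
  ; adj-irrefl = irr
  }
  where
  open import Relation.Binary.PropositionalEquality using (refl; cong₂; sym)
  open import Relation.Nullary.Decidable using (dec-true)
  sym′ : ∀ u v → (not ⌊ u ≟ᶠ v ⌋ ∧ ⌊ (toℕ u <ᵇ a) ≟ᵇ (toℕ v <ᵇ a) ⌋)
               ≡ (not ⌊ v ≟ᶠ u ⌋ ∧ ⌊ (toℕ v <ᵇ a) ≟ᵇ (toℕ u <ᵇ a) ⌋)
  sym′ u v with u ≟ᶠ v | v ≟ᶠ u | (toℕ u <ᵇ a) ≟ᵇ (toℕ v <ᵇ a) | (toℕ v <ᵇ a) ≟ᵇ (toℕ u <ᵇ a)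
  ... | yes _ | yes _ | _ | _ = refl
  ... | yes p | no q | _ | _ = Data.Empty.⊥-elim (q (sym p))
    where import Data.Empty
  ... | no p | yes q | _ | _ = Data.Empty.⊥-elim (p (sym q))
    where import Data.Empty
  ... | no _ | no _ | yes _ | yes _ = refl
  ... | no _ | no _ | no _ | no _ = refl
  ... | no _ | no _ | yes p | no q = Data.Empty.⊥-elim (q (sym p))
    where import Data.Empty
  ... | no _ | no _ | no p | yes q = Data.Empty.⊥-elim (p (sym q))
    where import Data.Empty
  irr : ∀ u → (not ⌊ u ≟ᶠ u ⌋ ∧ ⌊ (toℕ u <ᵇ a) ≟ᵇ (toℕ u <ᵇ a) ⌋) ≡ false
  irr u with u ≟ᶠ u
  ... | yes _ = refl
  ... | no p = Data.Empty.⊥-elim (p refl)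
    where import Data.Empty

G₂ : (c N : ℕ) → Graph
G₂ c N with c Data.Nat.≟ 2 | 4 ∣? N
  where import Data.Nat
... | yes _ | no _ = twoCliques (N Data.Nat./ 2) (N Data.Nat./ 2)
  where import Data.Nat
... | _ | _ = twoCliques (⌊ N /2⌋ + 1) (⌈ N /2⌉ ∸ 1)

{-# OPTIONS --safe #-}
-- Every component of H has order divisible by c = hcf_c(H), hence so has every set of
-- vertices of H closed under adjacency.  In a perfect H-packing of G, an adjacency-closed
-- set of vertices of G meets every copy of H in such a set, so its size is divisible by c;
-- for G₂ this makes c divide both clique orders.  With two cliques of order k|H|/2 this
-- forces 4 ∣ k|H|, excluded in that case.  Otherwise c divides the difference of the
-- clique orders, which is 1 or 2, so c = 2; but then 4 ∣ k|H| and ⌊k|H|/2⌋ + 1 is odd.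
module Submission where

open import Defs
open import Data.Nat using (ℕ; _*_; _<_)
open import Relation.Nullary using (¬_)
open import Relation.Binary.PropositionalEquality using (_≢_)

open import Data.Bool using (Bool; true; false; _∧_; _∨_; not)
open import Data.Bool.ListAction using (or)
open import Data.Bool.Properties using (T-≡; T-∧; T-∨; ⇔→≡; ¬-not; ∧-zeroʳ) renaming (_≟_ to _≟ᵇ_)
open import Data.Empty using (⊥-elim)
open import Data.Fin using (Fin; zero; suc; toℕ; _↑ˡ_; _↑ʳ_; combine; remQuot) renaming (_≟_ to _≟ᶠ_)
open import Data.Fin.Properties using (any?; *↔×; remQuot-combine)
open import Data.Fin.Permutation using (Permutation)
open import Data.List using (List; _∷_; foldr; map; length; filterᵇ; tabulate; allFin)
open import Data.List.Membership.Propositional using (_∈_; lose)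
open import Data.List.Membership.Propositional.Properties using (∈-allFin; ∈-map⁺)
open import Data.List.Properties using (map-cong)
open import Data.List.Relation.Unary.Any using (here; there; satisfied)
open import Data.List.Relation.Unary.Any.Properties using (any⁺; any⁻)
open import Data.Nat using (zero; suc; _+_; _≤_; z≤n; s≤s; _<ᵇ_; _∸_; ⌊_/2⌋; ⌈_/2⌉; _/_; _≟_)
open import Data.Nat.Divisibility
open import Data.Nat.DivMod using (m*n/n≡m)
open import Data.Nat.GCD using (gcd; gcd[m,n]∣m; gcd[m,n]∣n)
open import Data.Nat.Induction using (<-wellFounded)
open import Data.Nat.Primality using (prime⇒irreducible; prime[2])
open import Data.Nat.Properties
open import Algebra.Properties.CommutativeMonoid.Sum +-0-commutativeMonoid
  using (sum-syntax; sum-cong-≗; sum-replicate-zero; sum-remove; ∑-distrib-+; sum-permute)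
open import Data.Product using (∃; ∃₂; ∃-syntax; _×_; _,_; proj₁; proj₂; uncurry)
open import Data.Sum using (_⊎_; inj₁; inj₂; [_,_])
import Data.Sum as Sum
open import Function using (_∘_; Equivalence; _↔_; mk⇔; mk↔ₛ′)
open import Function.Construct.Composition using (_↔-∘_)
open import Induction.WellFounded using (Acc; acc)
open import Relation.Nullary using (yes; no)
open import Relation.Nullary.Decidable using (toWitness; fromWitness)
open import Relation.Binary.PropositionalEquality
  using (_≡_; _≗_; refl; sym; trans; cong; cong₂; subst; module ≡-Reasoning)

open Equivalence using (to; from)

private
  variable
    a b c m n h : ℕ

indicator : Bool → ℕ
indicator true  = 1
indicator false = 0

count : (Fin n → Bool) → ℕ
count {n} S = ∑[ x < n ] indicator (S x)

∑-split : (f : Fin (a + b) → ℕ) →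
  ∑[ k < a + b ] f k ≡ ∑[ i < a ] f (i ↑ˡ b) + ∑[ j < b ] f (a ↑ʳ j)
∑-split {zero}  f = refl
∑-split {suc a} {b} f =
  trans (cong (f zero +_) (∑-split {a} {b} (f ∘ suc))) (sym (+-assoc (f zero) _ _))

∑-combine : (f : Fin (m * h) → ℕ) →
  ∑[ k < m * h ] f k ≡ ∑[ i < m ] ∑[ u < h ] f (combine i u)
∑-combine {zero}      f = refl
∑-combine {suc m} {h} f =
  trans (∑-split {h} f) (cong (∑[ u < h ] f (u ↑ˡ m * h) +_) (∑-combine {m} (λ k → f (h ↑ʳ k))))

∣-∑ : (f : Fin n → ℕ) → (∀ i → c ∣ f i) → c ∣ ∑[ i < n ] f i
∣-∑ {zero}  f c∣f = _ ∣0
∣-∑ {suc n} f c∣f = ∣m∣n⇒∣m+n (c∣f zero) (∣-∑ (f ∘ suc) (c∣f ∘ suc))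

count-≤ : (S : Fin n → Bool) → count S ≤ n
count-≤ {zero}  S = z≤n
count-≤ {suc n} S = +-mono-≤ (indicator≤1 (S zero)) (count-≤ (S ∘ suc))
  where
  indicator≤1 : ∀ x → indicator x ≤ 1
  indicator≤1 true  = s≤s z≤n
  indicator≤1 false = z≤n

count-true : count {n} (λ _ → true) ≡ n
count-true {zero}  = refl
count-true {suc n} = cong suc (count-true {n})

count-false : {S : Fin n → Bool} → (∀ x → S x ≡ false) → count S ≡ 0
count-false {n} none = trans (sum-cong-≗ (cong indicator ∘ none)) (sum-replicate-zero n)

count-pos : {S : Fin n → Bool} (x : Fin n) → S x ≡ true → 0 < count S
count-pos {suc n} {S} x Sx rewrite sum-remove {i = x} (indicator ∘ S) | Sx = s≤s z≤n

count-split : (S P : Fin n → Bool) →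
  count S ≡ count (λ x → S x ∧ P x) + count (λ x → S x ∧ not (P x))
count-split S P =
  trans (sum-cong-≗ (λ x → indicator-split (S x) (P x))) (∑-distrib-+ (λ x → indicator (S x ∧ P x)) _)
  where
  indicator-split : ∀ s p → indicator s ≡ indicator (s ∧ p) + indicator (s ∧ not p)
  indicator-split true  true  = refl
  indicator-split true  false = refl
  indicator-split false p     = refl

module _ {S R : Fin n → Bool} (S⊆R : ∀ x → S x ≡ true → R x ≡ true) where

  ⊂⇒count< : (x : Fin n) → S x ≡ false → R x ≡ true → count S < count R
  ⊂⇒count< x Sx Rx = begin-strict
    count S                                                          ≡⟨ sum-cong-≗ R∧S≗S ⟨
    count (λ y → R y ∧ S y)                                          <⟨ m<m+n _ (count-pos x R∧¬S[x]) ⟩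
    count (λ y → R y ∧ S y) + count (λ y → R y ∧ not (S y))          ≡⟨ count-split R S ⟨
    count R                                                          ∎
    where
    open ≤-Reasoning
    R∧S≗S : ∀ y → indicator (R y ∧ S y) ≡ indicator (S y)
    R∧S≗S y with S y in Sy
    ... | true  rewrite S⊆R y Sy = refl
    ... | false = cong indicator (∧-zeroʳ (R y))
    R∧¬S[x] : R x ∧ not (S x) ≡ true
    R∧¬S[x] rewrite Rx | Sx = refl

  ⊆∧count≤⇒≗ : count R ≤ count S → S ≗ R
  ⊆∧count≤⇒≗ R≤S x with S x in Sx | R x in Rx
  ... | true  | true  = refl
  ... | false | false = refl
  ... | true  | false = trans (sym (S⊆R x Sx)) Rx
  ... | false | true  = ⊥-elim (<⇒≱ (⊂⇒count< x Sx Rx) R≤S)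

module _ (S : ℕ → Fin n → Bool)
         (ascending : ∀ k x → S k x ≡ true → S (suc k) x ≡ true)
         (stays-stalled : ∀ k → S k ≗ S (suc k) → S (suc k) ≗ S (suc (suc k))) where

  private
    stalled-or-grown : ∀ k → S k ≗ S (suc k) ⊎ k ≤ count (S k)
    stalled-or-grown zero = inj₂ z≤n
    stalled-or-grown (suc k) with stalled-or-grown k
    ... | inj₁ stalled = inj₁ (stays-stalled k stalled)
    ... | inj₂ k≤∣Sₖ∣ with count (S (suc k)) ≤? count (S k)
    ...   | yes ∣Sₖ₊₁∣≤∣Sₖ∣ = inj₁ (stays-stalled k (⊆∧count≤⇒≗ (ascending k) ∣Sₖ₊₁∣≤∣Sₖ∣))
    ...   | no  ∣Sₖ₊₁∣≰∣Sₖ∣ = inj₂ (≤-trans (s≤s k≤∣Sₖ∣) (≰⇒> ∣Sₖ₊₁∣≰∣Sₖ∣))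

  ascending-chain-stable : S n ≗ S (suc n)
  ascending-chain-stable with stalled-or-grown n
  ... | inj₁ stalled = stalled
  ... | inj₂ n≤∣Sₙ∣  = ⊆∧count≤⇒≗ (ascending n) (≤-trans (count-≤ (S (suc n))) n≤∣Sₙ∣)

foldr-gcd-∣ : {xs : List ℕ} → a ∈ xs → foldr gcd 0 xs ∣ a
foldr-gcd-∣ (here refl) = gcd[m,n]∣m _ _
foldr-gcd-∣ {xs = x ∷ _} (there a∈xs) = ∣-trans (gcd[m,n]∣n x _) (foldr-gcd-∣ a∈xs)

length-filterᵇ-tabulate : {A : Set} (p : A → Bool) (f : Fin n → A) →
  length (filterᵇ p (tabulate f)) ≡ count (p ∘ f)
length-filterᵇ-tabulate {zero}  p f = refl
length-filterᵇ-tabulate {suc n} p f with p (f zero)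
... | true  = cong suc (length-filterᵇ-tabulate p (f ∘ suc))
... | false = length-filterᵇ-tabulate p (f ∘ suc)

AdjacencyClosed : (G : Graph) → (Fin (order G) → Bool) → Set
AdjacencyClosed G S = ∀ u v → adj G u v ≡ true → S u ≡ S v

module _ (G : Graph) where

  reachWithin-refl : ∀ k u → reachWithin G k u u ≡ true
  reachWithin-refl zero    u = to T-≡ (fromWitness {a? = u ≟ᶠ u} refl)
  reachWithin-refl (suc k) u rewrite reachWithin-refl k u = refl

  reachWithin-mono : ∀ k {u v} → reachWithin G k u v ≡ true → reachWithin G (suc k) u v ≡ true
  reachWithin-mono k r rewrite r = refl

  reachWithin-step : ∀ k {u w v} → reachWithin G k u w ≡ true → adj G w v ≡ true →
    reachWithin G (suc k) u v ≡ true
  reachWithin-step k {w = w} r a =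
    to T-≡ (from T-∨ (inj₂ (any⁺ _ (lose (∈-allFin w) (from T-∧ (from T-≡ r , from T-≡ a))))))

  closed⇒reachWithin-invariant : {S : Fin (order G) → Bool} → AdjacencyClosed G S →
    ∀ k {u v} → reachWithin G k u v ≡ true → S u ≡ S v
  closed⇒reachWithin-invariant {S} closed zero r = cong S (toWitness (from T-≡ r))
  closed⇒reachWithin-invariant closed (suc k) {u} {v} r with reachWithin G k u v in r′
  ... | true  = closed⇒reachWithin-invariant closed k r′
  ... | false with w , Rw∧a ← satisfied (any⁻ _ (allFin _) (from T-≡ r))
              with Rw , a ← to T-∧ Rw∧a
    = trans (closed⇒reachWithin-invariant closed k (to T-≡ Rw)) (closed w v (to T-≡ a))

  -- The sets reachable within k steps grow with k and, once they stall, stay put.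
  reachWithin-stable : ∀ u → reachWithin G (order G) u ≗ reachWithin G (suc (order G)) u
  reachWithin-stable u =
    ascending-chain-stable (λ k → reachWithin G k u) (λ k x → reachWithin-mono k) stays-stalled
    where
    stays-stalled : ∀ k → reachWithin G k u ≗ reachWithin G (suc k) u →
      reachWithin G (suc k) u ≗ reachWithin G (suc (suc k)) u
    stays-stalled k eq x =
      cong₂ _∨_ (eq x) (cong or (map-cong (λ w → cong (_∧ adj G w x) (eq w)) (allFin _)))

  sameComponent-closed : ∀ u → AdjacencyClosed G (sameComponent G u)
  sameComponent-closed u x y x~y = ⇔→≡ (mk⇔ (extend x~y) (extend (trans (adj-sym G y x) x~y)))
    where
    extend : ∀ {x y} → adj G x y ≡ true → sameComponent G u x ≡ true → sameComponent G u y ≡ true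
    extend x~y r = trans (reachWithin-stable u _) (reachWithin-step (order G) r x~y)

  hcfc∣count-sameComponent : ∀ u → hcfc G ∣ count (sameComponent G u)
  hcfc∣count-sameComponent u =
    subst (hcfc G ∣_) (length-filterᵇ-tabulate (sameComponent G u) (λ x → x))
      (foldr-gcd-∣ (∈-map⁺ (componentOrder G) (∈-allFin u)))

  hcfc∣count : {S : Fin (order G) → Bool} → AdjacencyClosed G S → hcfc G ∣ count S
  hcfc∣count {S} = go S (<-wellFounded (count S))
    where
    -- Peel off the component of some vertex of S, and recurse on the rest.
    go : ∀ S → Acc _<_ (count S) → AdjacencyClosed G S → hcfc G ∣ count S
    go S (acc smaller) closed with any? (λ u → S u ≟ᵇ true)
    ... | no ∄u =
      subst (hcfc G ∣_) (sym (count-false (λ u → ¬-not (λ Su → ∄u (u , Su))))) (hcfc G ∣0)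
    ... | yes (u , Su) = subst (hcfc G ∣_) (sym (count-split S C)) (∣m∣n⇒∣m+n component rest)
      where
      C = sameComponent G u
      C⊆S : ∀ x → S x ∧ C x ≡ C x
      C⊆S x with C x in Cx
      ... | true  rewrite sym (closed⇒reachWithin-invariant closed (order G) Cx) | Su = refl
      ... | false = ∧-zeroʳ (S x)
      component : hcfc G ∣ count (λ x → S x ∧ C x)
      component = subst (hcfc G ∣_) (sum-cong-≗ (cong indicator ∘ sym ∘ C⊆S)) (hcfc∣count-sameComponent u)
      shrinks : count (λ x → S x ∧ not (C x)) < count S
      shrinks = subst (count (λ x → S x ∧ not (C x)) <_) (sym (count-split S C))
        (m<n+m _ (count-pos u (trans (C⊆S u) (reachWithin-refl (order G) u))))
      rest : hcfc G ∣ count (λ x → S x ∧ not (C x))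
      rest = go _ (smaller shrinks)
        (λ x y x~y → cong₂ (λ s c → s ∧ not c) (closed x y x~y) (sameComponent-closed u x y x~y))

packing⇒hcfc∣count : (H G : Graph) → PerfectPacking H G →
  {S : Fin (order G) → Bool} → AdjacencyClosed G S → hcfc H ∣ count S
packing⇒hcfc∣count H G (m , e , hom , inj , cover) {S} closed =
  subst (hcfc H ∣_) (sym count-by-copies) (∣-∑ _ (λ i → hcfc∣count H (copy-closed i)))
  where
  copies : (Fin m × Fin (order H)) ↔ Fin (order G)
  copies = mk↔ₛ′ (uncurry e) (λ x → let i , u , _ = cover x in i , u)
    (λ x → proj₂ (proj₂ (cover x)))
    (λ (i , u) → let j , v , eq = cover (e i u) ; j≡i , v≡u = inj j i v u eq in cong₂ _,_ j≡i v≡u)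
  π : Permutation (m * order H) (order G)
  π = copies ↔-∘ *↔×
  copy-closed : ∀ i → AdjacencyClosed H (S ∘ e i)
  copy-closed i u v u~v = closed _ _ (hom i u v u~v)
  count-by-copies : count S ≡ ∑[ i < m ] count (S ∘ e i)
  count-by-copies = begin
    count S                                                           ≡⟨ sum-permute _ π ⟩
    ∑[ k < m * order H ] indicator (S (uncurry e (remQuot _ k)))      ≡⟨ ∑-combine {m} _ ⟩
    ∑[ i < m ] ∑[ u < order H ] indicator (S (uncurry e (remQuot _ (combine i u))))
      ≡⟨ sum-cong-≗ (λ i → sum-cong-≗ (λ u → cong (indicator ∘ S ∘ uncurry e) (remQuot-combine i u))) ⟩
    ∑[ i < m ] count (S ∘ e i)                                        ∎
    where open ≡-Reasoning

inFirstClique : ∀ a {b} → Fin (a + b) → Bool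
inFirstClique a x = toℕ x <ᵇ a

inFirstClique-closed : ∀ a b → AdjacencyClosed (twoCliques a b) (inFirstClique a)
inFirstClique-closed a b u v u~v =
  toWitness {a? = inFirstClique a u ≟ᵇ inFirstClique a v} (proj₂ (to T-∧ (from T-≡ u~v)))

count-inFirstClique : ∀ a b → count (inFirstClique a {b}) ≡ a
count-inFirstClique zero    b = count-false {S = inFirstClique 0 {b}} (λ _ → refl)
count-inFirstClique (suc a) b = cong suc (count-inFirstClique a b)

count-notInFirstClique : ∀ a b → count (not ∘ inFirstClique a {b}) ≡ b
count-notInFirstClique zero    b = count-true
count-notInFirstClique (suc a) b = count-notInFirstClique a b

packing-twoCliques⇒hcfc∣ : (H : Graph) → PerfectPacking H (twoCliques a b) → hcfc H ∣ a × hcfc H ∣ b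
packing-twoCliques⇒hcfc∣ {a} {b} H packing =
  subst (hcfc H ∣_) (count-inFirstClique a b)
    (packing⇒hcfc∣count H (twoCliques a b) packing (inFirstClique-closed a b)) ,
  subst (hcfc H ∣_) (count-notInFirstClique a b)
    (packing⇒hcfc∣count H (twoCliques a b) packing {not ∘ inFirstClique a}
      (λ u v u~v → cong not (inFirstClique-closed a b u v u~v)))

⌈n/2⌉≡⌊n/2⌋⊎1+⌊n/2⌋ : ∀ n → ⌈ n /2⌉ ≡ ⌊ n /2⌋ ⊎ ⌈ n /2⌉ ≡ suc ⌊ n /2⌋
⌈n/2⌉≡⌊n/2⌋⊎1+⌊n/2⌋ zero          = inj₁ refl
⌈n/2⌉≡⌊n/2⌋⊎1+⌊n/2⌋ (suc zero)    = inj₂ refl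
⌈n/2⌉≡⌊n/2⌋⊎1+⌊n/2⌋ (suc (suc n)) = Sum.map (cong suc) (cong suc) (⌈n/2⌉≡⌊n/2⌋⊎1+⌊n/2⌋ n)

∣⌊n/2⌋+1∧∣⌈n/2⌉∸1⇒∣2 : ∀ n → c ∣ ⌊ n /2⌋ + 1 → c ∣ ⌈ n /2⌉ ∸ 1 → c ∣ 2
∣⌊n/2⌋+1∧∣⌈n/2⌉∸1⇒∣2 {c} n c∣a c∣b with ⌊ n /2⌋ | ⌈ n /2⌉ | ⌈n/2⌉≡⌊n/2⌋⊎1+⌊n/2⌋ n
... | zero  | _ | inj₁ refl = ∣-trans c∣a (1∣ 2)
... | suc q | _ | inj₁ refl = ∣m+n∣m⇒∣n (subst (c ∣_) (sym (+-suc q 1)) c∣a) c∣b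
... | q     | _ | inj₂ refl = ∣-trans (∣m+n∣m⇒∣n c∣a c∣b) (1∣ 2)

4∣n⇒2∣⌊n/2⌋ : 4 ∣ n → 2 ∣ ⌊ n /2⌋
4∣n⇒2∣⌊n/2⌋ (divides-refl q) = subst (2 ∣_) (sym ⌊q*4/2⌋≡q*2) (n∣m*n q)
  where
  ⌊n*2/2⌋≡n : ∀ n → ⌊ n * 2 /2⌋ ≡ n
  ⌊n*2/2⌋≡n zero    = refl
  ⌊n*2/2⌋≡n (suc n) = cong suc (⌊n*2/2⌋≡n n)
  ⌊q*4/2⌋≡q*2 : ⌊ q * 4 /2⌋ ≡ q * 2
  ⌊q*4/2⌋≡q*2 = trans (cong ⌊_/2⌋ (sym (*-assoc q 2 2))) (⌊n*2/2⌋≡n (q * 2))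

2∣n∧2∣n/2⇒4∣n : 2 ∣ n → 2 ∣ n / 2 → 4 ∣ n
2∣n∧2∣n/2⇒4∣n (divides-refl q) 2∣n/2 = *-pres-∣ (subst (2 ∣_) (m*n/n≡m q 2) 2∣n/2) (∣-refl {2})

2∤1 : ¬ 2 ∣ 1
2∤1 2∣1 with () ← ∣1⇒≡1 2∣1

G₂≡twoCliques-indivisible : c ≢ 1 → c ∣ n →
  ∃₂ λ a b → G₂ c n ≡ twoCliques a b × ¬ (c ∣ a × c ∣ b)
G₂≡twoCliques-indivisible {c} {n} c≢1 c∣n with c ≟ 2 | 4 ∣? n
... | yes refl | no 4∤n  = _ , _ , refl , λ (2∣a , _) → 4∤n (2∣n∧2∣n/2⇒4∣n c∣n 2∣a)
... | yes refl | yes 4∣n = _ , _ , refl , λ (2∣a , _) → 2∤1 (∣m+n∣m⇒∣n 2∣a (4∣n⇒2∣⌊n/2⌋ 4∣n))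
... | no c≢2   | _       = _ , _ , refl , λ (c∣a , c∣b) →
  [ c≢1 , c≢2 ] (prime⇒irreducible prime[2] (∣⌊n/2⌋+1∧∣⌈n/2⌉∸1⇒∣2 n c∣a c∣b))

hcfc∣order : (G : Graph) → hcfc G ∣ order G
hcfc∣order G = subst (hcfc G ∣_) count-true (hcfc∣count G {λ _ → true} (λ _ _ _ → refl))

proposition7 : (H : Graph) → Bipartite H → hcfc H ≢ 1 → 0 < ∣ H ∣ᵥ →
    (k : ℕ) → 0 < k → ¬ PerfectPacking H (G₂ (hcfc H) (k * ∣ H ∣ᵥ))
proposition7 H _ hcfc≢1 _ k _ packing
  with a , b , G₂≡ , indivisible ← G₂≡twoCliques-indivisible hcfc≢1 (∣n⇒∣m*n k (hcfc∣order H))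
  = indivisible (packing-twoCliques⇒hcfc∣ H (subst (PerfectPacking H) G₂≡ packing))
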